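{- Let $m \geqslant 11$ be an odd integer. The digraph $G_{2m} = \vec{X}(m, \{1,3\}) \wr K^*_2$ admits a $\vec{C}_m$-factorization.
   Context: $\vec{X}(m,\{1,3\})$ is the directed circulant with vertex set $\mathbb{Z}_m$ and arcs $(a,a+1)$, $(a,a+3)$ (mod $m$). $K^*_2$ is the complete symmetric digraph on two vertices (two vertices joined by arcs in both directions). The wreath product $G \wr H$ of digraphs has vertex set $V(G)\times V(H)$ and an arc from $(g_1,h_1)$ to $(g_2,h_2)$ iff $(g_1,g_2)\in A(G)$, or $g_1=g_2$ and $(h_1,h_2)\in A(H)$. A $\vec{C}_m$-factor of a digraph is a spanning subdigraph that is a disjoint union of directed $m$-cycles; a $\vec{C}_m$-factorization is a partition of the arc set into the arc sets of $\vec{C}_m$-factors. -}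

module Defs where

open import Level using (0ℓ)
open import Data.Nat using (ℕ; suc; _+_; _%_; NonZero)
open import Data.Nat.DivMod using (m%n<n)
open import Data.Fin using (Fin; toℕ; fromℕ<)
open import Data.List using (List; _∷_; [])
open import Data.List.Membership.Propositional using (_∈_)
open import Data.Product using (Σ; ∃; _×_; _,_)
open import Data.Sum using (_⊎_)
open import Relation.Binary.PropositionalEquality using (_≡_; _≢_)

record Digraph : Set₁ where
  field
    V   : Set
    Arc : V → V → Set
open Digraph public

circulant : (m : ℕ) .{{_ : NonZero m}} → List ℕ → Digraph
circulant m S = record
  { V   = Fin m
  ; Arc = λ a b → Σ ℕ λ s → s ∈ S × (toℕ a + s) % m ≡ toℕ b }

K2* : Digraph
K2* = record { V = Fin 2 ; Arc = λ x y → x ≢ y }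

_≀_ : Digraph → Digraph → Digraph
G ≀ H = record
  { V   = V G × V H
  ; Arc = λ { (g₁ , h₁) (g₂ , h₂) →
              Arc G g₁ g₂ ⊎ (g₁ ≡ g₂ × Arc H h₁ h₂) } }

next : {m : ℕ} .{{_ : NonZero m}} → Fin m → Fin m
next {m} j = fromℕ< (m%n<n (suc (toℕ j)) m)

-- A C_m-factorization of G, given explicitly: k factors, each factor c
-- consisting of t directed m-cycles  cyc c i 0 → cyc c i 1 → … → cyc c i (m-1) → cyc c i 0.
record CmFactorization (m : ℕ) .{{_ : NonZero m}} (G : Digraph) : Set where
  field
    k   : ℕ
    t   : ℕ
    cyc : Fin k → Fin t → Fin m → V G
    injective  : ∀ c i j i′ j′ → cyc c i j ≡ cyc c i′ j′ → i ≡ i′ × j ≡ j′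
    spanning   : ∀ c (v : V G) → Σ (Fin t) λ i → Σ (Fin m) λ j → cyc c i j ≡ v
    arcs-in-G  : ∀ c i j → Arc G (cyc c i j) (cyc c i (next j))
    covers     : ∀ u v → Arc G u v →
                 Σ (Fin k) λ c → Σ (Fin t) λ i → Σ (Fin m) λ j →
                   cyc c i j ≡ u × cyc c i (next j) ≡ v
    unique     : ∀ u v c i j c′ i′ j′ →
                 cyc c i j ≡ u → cyc c i (next j) ≡ v →
                 cyc c′ i′ j′ ≡ u → cyc c′ i′ (next j′) ≡ v →
                 c ≡ c′ × i ≡ i′ × j ≡ j′

G2m : (m : ℕ) .{{_ : NonZero m}} → Digraph
G2m m = circulant m (1 ∷ 3 ∷ []) ≀ K2*

-- Write m = W + 4n with W ∈ {9, 11} and cut the columns Z_m into n blocks of four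
-- columns followed by a window of W columns.  Each vertex (x , h) has five out-arcs: to
-- x + 1 or x + 3 on either level, and to x on the other level.  A factor is a permutation
-- σ_c of the vertices sending each vertex along one of its out-arcs, and at every vertex
-- the five factors use the five arcs once each, so each arc lies in exactly one factor.
-- The arc σ_c takes depends only on the level and on the position inside a block or the
-- window, so finitely many tables describe the factors for all n.  To see that σ_c is a
-- union of two m-cycles, every vertex gets a label in {0, 1} and a height, affine in n
-- and in the block index, which σ_c raises by one modulo m without changing the label;
-- the two vertices of height 0 then generate the two cycles.  The tables for W = 9 and
-- W = 11 are verified by evaluation.

module Submission where

open import Defs
open import Data.Nat
  using (ℕ; zero; suc; _+_; _*_; _∸_; _/_; _%_; _<_; _≤_; _<?_; _≤?_; _≟_; NonZero; z≤n; s≤s)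
open import Data.Nat.Properties
  using (n<1+n; <-irrefl; <-trans; ≤-trans; ≤-reflexive; ≤-antisym; ≮⇒≥; <⇒≱; <⇒≢;
         m≤n⇒m<n∨m≡n; m≤m+n; m≤n+m; +-comm; +-assoc; +-identityʳ; *-comm; *-suc; *-zeroʳ;
         +-cancelˡ-≡; +-cancelʳ-≡; *-cancelˡ-≡; +-mono-<; +-monoʳ-<; +-monoʳ-≤; *-monoʳ-≤;
         ∸-monoˡ-<; ∸-monoˡ-≤; m+n∸n≡m; m∸n+n≡m; m+[n∸m]≡n; module ≤-Reasoning)
open import Data.Nat.DivMod
  using (m<n⇒m%n≡m; n%n≡0; m%n<n; m≤n⇒[n∸m]%m≡n%m; [m+n]%n≡m%n; [m+kn]%n≡m%n;
         m≡m%n+[m/n]*n; m∣n⇒o%n%m≡o%m)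
open import Data.Nat.Divisibility using (divides)
open import Data.Nat.Tactic.RingSolver using (solve-∀)
open import Data.Fin
  using (Fin; zero; suc; toℕ; fromℕ<; opposite; punchOut; combine; remQuot)
  renaming (_<_ to _<ᶠ_)
open import Data.Fin.Properties
  using (pigeonhole; punchOut-injective; all?; any?; toℕ-injective; toℕ<n; toℕ-fromℕ<;
         combine-remQuot; combine-injective)
  renaming (_≟_ to _≟ᶠ_; <⇒≢ to <ᶠ⇒≢)
open import Data.Vec using (Vec; _∷_; []; lookup)
open import Data.List.Relation.Unary.Any using (here; there)
open import Data.Product using (Σ; ∃; ∃₂; _×_; _,_; proj₁; proj₂; uncurry)
open import Data.Product.Properties using (,-injective)
open import Data.Sum using (_⊎_; inj₁; inj₂) renaming (map to ⊎-map)
open import Data.Empty using (⊥-elim)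
open import Data.Unit using (tt)
open import Function.Base using (_∘_)
open import Function.Definitions using (Injective)
open import Relation.Nullary using (Dec; yes; no; ¬_; _×-dec_; _⊎-dec_; _→-dec_)
open import Relation.Nullary.Decidable using (map′; toWitness)
open import Relation.Binary.PropositionalEquality

injective⇒surjective : ∀ {n} (f : Fin n → Fin n) → Injective _≡_ _≡_ f →
                       ∀ y → ∃ λ x → f x ≡ y
injective⇒surjective {zero}  f f-inj ()
injective⇒surjective {suc n} f f-inj y with any? (λ x → f x ≟ᶠ y)
... | yes hit = hit
... | no miss = ⊥-elim (no-collision (pigeonhole (n<1+n n) (λ x → punchOut (avoids x))))
  where
  avoids : ∀ x → y ≢ f x
  avoids x y≡fx = miss (x , sym y≡fx)
  no-collision : ¬ (∃₂ λ i j → i <ᶠ j × punchOut (avoids i) ≡ punchOut (avoids j))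
  no-collision (i , j , i<j , eq) = <ᶠ⇒≢ i<j (f-inj (punchOut-injective (avoids i) (avoids j) eq))

×-injective⇒surjective : ∀ {m n} (f : Fin m × Fin n → Fin m × Fin n) →
                         Injective _≡_ _≡_ f → ∀ y → ∃ λ x → f x ≡ y
×-injective⇒surjective {m} {n} f f-inj y = preimage (injective⇒surjective f′ f′-inj (uncurry combine y))
  where
  uncurry-combine-injective : ∀ {a b : Fin m × Fin n} → uncurry combine a ≡ uncurry combine b → a ≡ b
  uncurry-combine-injective {a₁ , a₂} {b₁ , b₂} eq with combine-injective a₁ a₂ b₁ b₂ eq
  ... | refl , refl = refl
  f′ : Fin (m * n) → Fin (m * n)
  f′ x = uncurry combine (f (remQuot {m} n x))
  f′-inj : Injective _≡_ _≡_ f′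
  f′-inj {x} {x′} eq = begin
    x                                   ≡⟨ combine-remQuot {m} n x ⟨
    uncurry combine (remQuot {m} n x)   ≡⟨ cong (uncurry combine) (f-inj (uncurry-combine-injective eq)) ⟩
    uncurry combine (remQuot {m} n x′)  ≡⟨ combine-remQuot {m} n x′ ⟩
    x′                                  ∎
    where open ≡-Reasoning
  preimage : (∃ λ x → f′ x ≡ uncurry combine y) → ∃ λ x → f x ≡ y
  preimage (x , f′x≡y) = remQuot {m} n x , uncurry-combine-injective f′x≡y

iterate : {A : Set} → (A → A) → ℕ → A → A
iterate f zero    x = x
iterate f (suc k) x = f (iterate f k x)

Advances : ∀ {t} → ℕ → Fin t × ℕ → Fin t × ℕ → Set
Advances m (i , τ) (i′ , τ′) = i′ ≡ i × (τ′ ≡ suc τ ⊎ (suc τ ≡ m × τ′ ≡ 0))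

-- The t·m iterates σʲ (base i), j < m, have distinct labelled heights, and V embeds into
-- Fin m × Fin t, so they exhaust V.
module CyclesFromHeight
  {V : Set} {m t : ℕ} .{{_ : NonZero m}}
  (σ : V → V) (φ : V → Fin t × ℕ) (φ-advances : ∀ v → Advances m (φ v) (φ (σ v)))
  (base : Fin t → V) (φ-base : ∀ i → φ (base i) ≡ (i , 0))
  (ext : V → Fin m × Fin t) (ext-injective : Injective _≡_ _≡_ ext)
  where

  cycle : Fin t → Fin m → V
  cycle i j = iterate σ (toℕ j) (base i)

  advances-below : ∀ {i : Fin t} {τ p} → Advances m (i , τ) p → suc τ < m → p ≡ (i , suc τ)
  advances-below (refl , inj₁ refl)      _  = refl
  advances-below (refl , inj₂ (τ+1≡m , _)) lt = ⊥-elim (<-irrefl τ+1≡m lt)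

  φ-iterate : ∀ i j → j < m → φ (iterate σ j (base i)) ≡ (i , j)
  φ-iterate i zero    _  = φ-base i
  φ-iterate i (suc j) lt = advances-below (subst (λ p → Advances m p (φ (σ x))) φx≡[i,j] (φ-advances x)) lt
    where
    x : V
    x = iterate σ j (base i)
    φx≡[i,j] : φ x ≡ (i , j)
    φx≡[i,j] = φ-iterate i j (<-trans (n<1+n j) lt)

  φ-cycle : ∀ i j → φ (cycle i j) ≡ (i , toℕ j)
  φ-cycle i j = φ-iterate i (toℕ j) (toℕ<n j)

  cycle-injective : ∀ i j i′ j′ → cycle i j ≡ cycle i′ j′ → i ≡ i′ × j ≡ j′
  cycle-injective i j i′ j′ eq
    with refl , τ≡τ′ ← ,-injective (trans (sym (φ-cycle i j)) (trans (cong φ eq) (φ-cycle i′ j′)))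
    = refl , toℕ-injective τ≡τ′

  ext∘cycle-surjective : ∀ v → Σ (Fin t) λ i → Σ (Fin m) λ j → ext (cycle i j) ≡ v
  ext∘cycle-surjective v = preimage (×-injective⇒surjective f f-inj v)
    where
    f : Fin m × Fin t → Fin m × Fin t
    f (j , i) = ext (cycle i j)
    f-inj : Injective _≡_ _≡_ f
    f-inj {j , i} {j′ , i′} eq with cycle-injective i j i′ j′ (ext-injective eq)
    ... | refl , refl = refl
    preimage : (∃ λ x → f x ≡ v) → Σ (Fin t) λ i → Σ (Fin m) λ j → ext (cycle i j) ≡ v
    preimage ((j , i) , eq) = i , j , eq

  cycle-surjective : ∀ u → Σ (Fin t) λ i → Σ (Fin m) λ j → cycle i j ≡ u
  cycle-surjective u with i , j , eq ← ext∘cycle-surjective (ext u) = i , j , ext-injective eq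

  ext-surjective : ∀ v → Σ V λ u → ext u ≡ v
  ext-surjective v with i , j , eq ← ext∘cycle-surjective v = cycle i j , eq

  φ-injective : Injective _≡_ _≡_ φ
  φ-injective {u} {v} φu≡φv
    with i , j , refl ← cycle-surjective u | i′ , j′ , refl ← cycle-surjective v
    with refl , τ≡τ′ ← ,-injective (trans (sym (φ-cycle i j)) (trans φu≡φv (φ-cycle i′ j′)))
    with refl ← toℕ-injective {i = j} {j = j′} τ≡τ′
    = refl

  φ-bounded : ∀ v → proj₂ (φ v) < m
  φ-bounded v with i , j , refl ← cycle-surjective v rewrite φ-cycle i j = toℕ<n j

  -- All heights are below m, so from height m - 1 the height must wrap to 0.
  σ-closes : ∀ i j → suc (toℕ j) ≡ m → σ (cycle i j) ≡ base i
  σ-closes i j τ+1≡m = φ-injective (trans (wraps _ advances (φ-bounded _)) (sym (φ-base i)))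
    where
    advances : Advances m (i , toℕ j) (φ (σ (cycle i j)))
    advances = subst (λ p → Advances m p (φ (σ (cycle i j)))) (φ-cycle i j) (φ-advances (cycle i j))
    wraps : ∀ p → Advances m (i , toℕ j) p → proj₂ p < m → p ≡ (i , 0)
    wraps _ (refl , inj₁ refl)      lt = ⊥-elim (<-irrefl τ+1≡m lt)
    wraps _ (refl , inj₂ (_ , refl)) _  = refl

  cycle-next : ∀ i j → cycle i (next j) ≡ σ (cycle i j)
  cycle-next i j with m≤n⇒m<n∨m≡n (toℕ<n j)
  ... | inj₁ τ+1<m = cong (λ τ → iterate σ τ (base i)) (trans (toℕ-fromℕ< _) (m<n⇒m%n≡m τ+1<m))
  ... | inj₂ τ+1≡m = begin
    iterate σ (toℕ (next j)) (base i)
      ≡⟨ cong (λ τ → iterate σ τ (base i)) (trans (toℕ-fromℕ< _) (wrap τ+1≡m)) ⟩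
    base i
      ≡⟨ σ-closes i j τ+1≡m ⟨
    σ (cycle i j) ∎
    where
    open ≡-Reasoning
    wrap : ∀ {k} → k ≡ m → k % m ≡ 0
    wrap refl = n%n≡0 m

-- Factor c leaves u along the arc of type rule c u.  Since at each u the rules run once
-- through the k types and every arc out of u has exactly one type, every arc lies in
-- exactly one factor.
module FactorizationFromRules
  (G : Digraph) {m k t : ℕ} .{{_ : NonZero m}}
  {U : Set} (ext : U → V G) (ext-injective : Injective _≡_ _≡_ ext)
  (ext-surjective : ∀ v → Σ U λ u → ext u ≡ v)
  (move : Fin k → U → U)
  (move-arc : ∀ r u → Arc G (ext u) (ext (move r u)))
  (arc-move : ∀ u v → Arc G (ext u) v → Σ (Fin k) λ r → ext (move r u) ≡ v)
  (move-injective : ∀ u {r r′} → ext (move r u) ≡ ext (move r′ u) → r ≡ r′)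
  (rule : Fin k → U → Fin k)
  (rule-injective : ∀ u {c c′} → rule c u ≡ rule c′ u → c ≡ c′)
  (rule-surjective : ∀ u r → Σ (Fin k) λ c → rule c u ≡ r)
  (cyc : Fin k → Fin t → Fin m → U)
  (cyc-injective : ∀ c i j i′ j′ → cyc c i j ≡ cyc c i′ j′ → i ≡ i′ × j ≡ j′)
  (cyc-surjective : ∀ c u → Σ (Fin t) λ i → Σ (Fin m) λ j → cyc c i j ≡ u)
  (cyc-next : ∀ c i j → cyc c i (next j) ≡ move (rule c (cyc c i j)) (cyc c i j))
  where

  σ : Fin k → U → U
  σ c u = move (rule c u) u

  covers : ∀ u v → Arc G u v → Σ (Fin k) λ c → Σ (Fin t) λ i → Σ (Fin m) λ j →
             ext (cyc c i j) ≡ u × ext (cyc c i (next j)) ≡ v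
  covers u v uv with u′ , refl ← ext-surjective u
    with r , moved ← arc-move u′ v uv
    with c , refl ← rule-surjective u′ r
    with i , j , refl ← cyc-surjective c u′
    = c , i , j , refl , trans (cong ext (cyc-next c i j)) moved

  same-source⇒same-factor : ∀ c i j c′ i′ j′ → cyc c i j ≡ cyc c′ i′ j′ →
                            ext (cyc c i (next j)) ≡ ext (cyc c′ i′ (next j′)) → c ≡ c′
  same-source⇒same-factor c i j c′ i′ j′ same-source same-target =
    rule-injective x (move-injective x (begin
      ext (σ c x)                ≡⟨ cong ext (cyc-next c i j) ⟨
      ext (cyc c i (next j))        ≡⟨ same-target ⟩
      ext (cyc c′ i′ (next j′))     ≡⟨ cong ext (cyc-next c′ i′ j′) ⟩
      ext (σ c′ (cyc c′ i′ j′))  ≡⟨ cong (λ y → ext (σ c′ y)) same-source ⟨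
      ext (σ c′ x)               ∎))
    where
    open ≡-Reasoning
    x : U
    x = cyc c i j

  unique : ∀ u v c i j c′ i′ j′ →
           ext (cyc c i j) ≡ u → ext (cyc c i (next j)) ≡ v →
           ext (cyc c′ i′ j′) ≡ u → ext (cyc c′ i′ (next j′)) ≡ v →
           c ≡ c′ × i ≡ i′ × j ≡ j′
  unique u v c i j c′ i′ j′ refl refl same-source same-target
    with refl ← same-source⇒same-factor c i j c′ i′ j′ (ext-injective (sym same-source)) (sym same-target)
    = refl , cyc-injective c i j i′ j′ (ext-injective (sym same-source))

  cmFactorization : CmFactorization m G
  cmFactorization = record
    { k         = k
    ; t         = t
    ; cyc       = λ c i j → ext (cyc c i j)
    ; injective = λ c i j i′ j′ eq → cyc-injective c i j i′ j′ (ext-injective eq)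
    ; spanning  = spanning
    ; arcs-in-G = λ c i j →
        subst (λ w → Arc G (ext (cyc c i j)) (ext w)) (sym (cyc-next c i j)) (move-arc _ _)
    ; covers    = covers
    ; unique    = unique
    }
    where
    spanning : ∀ c v → Σ (Fin t) λ i → Σ (Fin m) λ j → ext (cyc c i j) ≡ v
    spanning c v with u , refl ← ext-surjective v with i , j , refl ← cyc-surjective c u = i , j , refl

residue : ∀ k .{{_ : NonZero k}} → ℕ → Fin k
residue k x = fromℕ< (m%n<n x k)

toℕ-residue : ∀ k .{{_ : NonZero k}} {x} → x < k → toℕ (residue k x) ≡ x
toℕ-residue k {x} x<k = trans (toℕ-fromℕ< (m%n<n x k)) (m<n⇒m%n≡m x<k)

%-wraps-once : ∀ {a} M .{{_ : NonZero M}} → a < M + M → a % M ≡ a ⊎ a % M + M ≡ a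
%-wraps-once {a} M a<2M with a <? M
... | yes a<M = inj₁ (m<n⇒m%n≡m a<M)
... | no a≮M  = inj₂ (begin
  a % M + M        ≡⟨ cong (_+ M) (m≤n⇒[n∸m]%m≡n%m M≤a) ⟨
  (a ∸ M) % M + M  ≡⟨ cong (_+ M) (m<n⇒m%n≡m a∸M<M) ⟩
  a ∸ M + M        ≡⟨ m∸n+n≡m M≤a ⟩
  a                ∎)
  where
  open ≡-Reasoning
  M≤a : M ≤ a
  M≤a = ≮⇒≥ a≮M
  a∸M<M : a ∸ M < M
  a∸M<M = subst (a ∸ M <_) (m+n∸n≡m M M) (∸-monoˡ-< a<2M M≤a)

x+s+M≢x+s′ : ∀ {M} x s {s′} → s′ < M → x + s + M ≢ x + s′
x+s+M≢x+s′ {M} x s {s′} s′<M eq = <⇒≱ s′<M (≤-trans (m≤n+m M s) (≤-reflexive s+M≡s′))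
  where
  s+M≡s′ : s + M ≡ s′
  s+M≡s′ = +-cancelˡ-≡ x (s + M) s′ (trans (sym (+-assoc x s M)) eq)

+-cancelˡ-% : ∀ M {x s s′} .{{_ : NonZero M}} → x < M → s < M → s′ < M →
              (x + s) % M ≡ (x + s′) % M → s ≡ s′
+-cancelˡ-% M {x} {s} {s′} x<M s<M s′<M eq
  with %-wraps-once M (+-mono-< x<M s<M) | %-wraps-once M (+-mono-< x<M s′<M)
... | inj₁ e | inj₁ e′ = +-cancelˡ-≡ x s s′ (trans (sym e) (trans eq e′))
... | inj₂ e | inj₂ e′ = +-cancelˡ-≡ x s s′ (trans (sym e) (trans (cong (_+ M) eq) e′))
... | inj₁ e | inj₂ e′ = ⊥-elim (x+s+M≢x+s′ x s s′<M (trans (cong (_+ M) (trans (sym e) eq)) e′))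
... | inj₂ e | inj₁ e′ = ⊥-elim (x+s+M≢x+s′ x s′ s<M (trans (cong (_+ M) (trans (sym e′) (sym eq))) e))

arcStep : Fin 5 → ℕ
arcStep zero                            = 1
arcStep (suc zero)                      = 1
arcStep (suc (suc zero))                = 3
arcStep (suc (suc (suc zero)))          = 3
arcStep (suc (suc (suc (suc zero))))    = 0

arcLevel : Fin 5 → Fin 2 → Fin 2
arcLevel zero                         h = h
arcLevel (suc zero)                   h = opposite h
arcLevel (suc (suc zero))             h = h
arcLevel (suc (suc (suc zero)))       h = opposite h
arcLevel (suc (suc (suc (suc zero)))) h = opposite h

arcStep≤3 : ∀ r → arcStep r ≤ 3
arcStep≤3 r = toWitness {a? = all? λ r → arcStep r ≤? 3} tt r

arcType-injective : ∀ {r r′} h → arcStep r ≡ arcStep r′ → arcLevel r h ≡ arcLevel r′ h → r ≡ r′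
arcType-injective {r} {r′} h = toWitness {a? = all? λ r → all? λ r′ → all? λ h →
  (arcStep r ≟ arcStep r′) →-dec (arcLevel r h ≟ᶠ arcLevel r′ h) →-dec (r ≟ᶠ r′)} tt r r′ h

opposite-≢ : ∀ {h h′ : Fin 2} → h′ ≢ h → h′ ≡ opposite h
opposite-≢ {zero}     {zero}     h′≢h = ⊥-elim (h′≢h refl)
opposite-≢ {zero}     {suc zero} _    = refl
opposite-≢ {suc zero} {zero}     _    = refl
opposite-≢ {suc zero} {suc zero} h′≢h = ⊥-elim (h′≢h refl)

≢-opposite : ∀ (h : Fin 2) → h ≢ opposite h
≢-opposite zero       ()
≢-opposite (suc zero) ()

module ArcsOfG2m (M : ℕ) .{{_ : NonZero M}} where

  shift : Fin M → ℕ → Fin M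
  shift x s = residue M (toℕ x + s)

  toℕ-shift : ∀ x s → toℕ (shift x s) ≡ (toℕ x + s) % M
  toℕ-shift x s = toℕ-fromℕ< (m%n<n (toℕ x + s) M)

  shift-0 : ∀ x → shift x 0 ≡ x
  shift-0 x = toℕ-injective (begin
    toℕ (shift x 0)   ≡⟨ toℕ-shift x 0 ⟩
    (toℕ x + 0) % M   ≡⟨ cong (_% M) (+-identityʳ (toℕ x)) ⟩
    toℕ x % M         ≡⟨ m<n⇒m%n≡m (toℕ<n x) ⟩
    toℕ x             ∎)
    where open ≡-Reasoning

  shift-≡ : ∀ x s {x′} → (toℕ x + s) % M ≡ toℕ x′ → shift x s ≡ x′
  shift-≡ x s eq = toℕ-injective (trans (toℕ-shift x s) eq)

  arcTarget : Fin 5 → V (G2m M) → V (G2m M)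
  arcTarget r (x , h) = shift x (arcStep r) , arcLevel r h

  arcTarget-arc : ∀ r v → Arc (G2m M) v (arcTarget r v)
  arcTarget-arc zero                         (x , h) = inj₁ (1 , here refl , sym (toℕ-shift x 1))
  arcTarget-arc (suc zero)                   (x , h) = inj₁ (1 , here refl , sym (toℕ-shift x 1))
  arcTarget-arc (suc (suc zero))             (x , h) = inj₁ (3 , there (here refl) , sym (toℕ-shift x 3))
  arcTarget-arc (suc (suc (suc zero)))       (x , h) = inj₁ (3 , there (here refl) , sym (toℕ-shift x 3))
  arcTarget-arc (suc (suc (suc (suc zero)))) (x , h) = inj₂ (sym (shift-0 x) , ≢-opposite h)

  arc⇒arcTarget : ∀ v v′ → Arc (G2m M) v v′ → Σ (Fin 5) λ r → arcTarget r v ≡ v′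
  arc⇒arcTarget (x , h) (x′ , h′) (inj₁ (.1 , here refl , x+1≡x′)) with h′ ≟ᶠ h
  ... | yes refl = zero , cong₂ _,_ (shift-≡ x 1 x+1≡x′) refl
  ... | no h′≢h  = suc zero , cong₂ _,_ (shift-≡ x 1 x+1≡x′) (sym (opposite-≢ h′≢h))
  arc⇒arcTarget (x , h) (x′ , h′) (inj₁ (.3 , there (here refl) , x+3≡x′)) with h′ ≟ᶠ h
  ... | yes refl = suc (suc zero) , cong₂ _,_ (shift-≡ x 3 x+3≡x′) refl
  ... | no h′≢h  = suc (suc (suc zero)) , cong₂ _,_ (shift-≡ x 3 x+3≡x′) (sym (opposite-≢ h′≢h))
  arc⇒arcTarget (x , h) (x′ , h′) (inj₂ (refl , h≢h′)) =
    suc (suc (suc (suc zero))) , cong₂ _,_ (shift-0 x) (sym (opposite-≢ (h≢h′ ∘ sym)))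

  arcTarget-injective : 4 ≤ M → ∀ v {r r′} → arcTarget r v ≡ arcTarget r′ v → r ≡ r′
  arcTarget-injective 4≤M (x , h) {r} {r′} eq with ,-injective eq
  ... | same-column , same-level = arcType-injective h
        (+-cancelˡ-% M (toℕ<n x) (step<M r) (step<M r′) same-residue)
        same-level
    where
    step<M : ∀ r → arcStep r < M
    step<M r = ≤-trans (s≤s (arcStep≤3 r)) 4≤M
    same-residue : (toℕ x + arcStep r) % M ≡ (toℕ x + arcStep r′) % M
    same-residue = begin
      (toℕ x + arcStep r) % M      ≡⟨ toℕ-shift x (arcStep r) ⟨
      toℕ (shift x (arcStep r))    ≡⟨ cong toℕ same-column ⟩
      toℕ (shift x (arcStep r′))   ≡⟨ toℕ-shift x (arcStep r′) ⟩
      (toℕ x + arcStep r′) % M     ∎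
      where open ≡-Reasoning

4*[1+k]+x≡4*k+[4+x] : ∀ k x → 4 * suc k + x ≡ 4 * k + (4 + x)
4*[1+k]+x≡4*k+[4+x] k x = begin
  4 * suc k + x    ≡⟨ cong (_+ x) (*-suc 4 k) ⟩
  4 + 4 * k + x    ≡⟨ cong (_+ x) (+-comm 4 (4 * k)) ⟩
  4 * k + 4 + x    ≡⟨ +-assoc (4 * k) 4 x ⟩
  4 * k + (4 + x)  ∎
  where open ≡-Reasoning

4*k+q<4*n : ∀ {k n q} → k < n → q < 4 → 4 * k + q < 4 * n
4*k+q<4*n {k} {n} {q} k<n q<4 = begin-strict
  4 * k + q   <⟨ +-monoʳ-< (4 * k) q<4 ⟩
  4 * k + 4   ≡⟨ +-comm (4 * k) 4 ⟩
  4 + 4 * k   ≡⟨ *-suc 4 k ⟨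
  4 * suc k   ≤⟨ *-monoʳ-≤ 4 k<n ⟩
  4 * n       ∎
  where open ≤-Reasoning

[4*k+q]%4≡q : ∀ k {q} → q < 4 → (4 * k + q) % 4 ≡ q
[4*k+q]%4≡q k {q} q<4 = begin
  (4 * k + q) % 4  ≡⟨ cong (_% 4) (trans (+-comm (4 * k) q) (cong (q +_) (*-comm 4 k))) ⟩
  (q + k * 4) % 4  ≡⟨ [m+kn]%n≡m%n q k 4 ⟩
  q % 4            ≡⟨ m<n⇒m%n≡m q<4 ⟩
  q                ∎
  where open ≡-Reasoning

4*k+q-injective : ∀ {k k′ q q′} → q < 4 → q′ < 4 → 4 * k + q ≡ 4 * k′ + q′ → k ≡ k′ × q ≡ q′
4*k+q-injective {k} {k′} {q} {q′} q<4 q′<4 eq = k≡k′ , q≡q′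
  where
  q≡q′ : q ≡ q′
  q≡q′ = trans (sym ([4*k+q]%4≡q k q<4)) (trans (cong (_% 4) eq) ([4*k+q]%4≡q k′ q′<4))
  k≡k′ : k ≡ k′
  k≡k′ = *-cancelˡ-≡ k k′ 4 (+-cancelʳ-≡ q _ _ (trans eq (cong (4 * k′ +_) (sym q≡q′))))

[a+s]∸b≤2 : ∀ {a b s} → a < b → s ≤ 3 → a + s ∸ b ≤ 2
[a+s]∸b≤2 {a} {b} {s} a<b s≤3 = subst (a + s ∸ b ≤_) (m+n∸n≡m 2 b) (∸-monoˡ-≤ b (begin
  a + s      ≤⟨ +-monoʳ-≤ a s≤3 ⟩
  a + 3      ≡⟨ +-comm a 3 ⟩
  2 + suc a  ≤⟨ +-monoʳ-≤ 2 a<b ⟩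
  2 + b      ∎))
  where open ≤-Reasoning

carried-index : ∀ {q s} k → ¬ (q + s < 4) → 4 * suc k + (q + s ∸ 4) ≡ 4 * k + q + s
carried-index {q} {s} k q+s≮4 = begin
  4 * suc k + (q + s ∸ 4)    ≡⟨ 4*[1+k]+x≡4*k+[4+x] k (q + s ∸ 4) ⟩
  4 * k + (4 + (q + s ∸ 4))  ≡⟨ cong (4 * k +_) (m+[n∸m]≡n (≮⇒≥ q+s≮4)) ⟩
  4 * k + (q + s)            ≡⟨ +-assoc (4 * k) q s ⟨
  4 * k + q + s              ∎
  where open ≡-Reasoning

module ColumnLayout (d : ℕ) where

  W : ℕ
  W = 4 + d

  M : ℕ → ℕ
  M n = W + 4 * n

  data Column (n : ℕ) : Set where
    block  : Fin n → Fin 4 → Column n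
    window : Fin W → Column n

  index : ∀ {n} → Column n → ℕ
  index (block k q)    = 4 * toℕ k + toℕ q
  index {n} (window w) = 4 * n + toℕ w

  index<M : ∀ {n} (c : Column n) → index c < M n
  index<M {n} (block k q) = ≤-trans (4*k+q<4*n (toℕ<n k) (toℕ<n q)) (m≤n+m (4 * n) W)
  index<M {n} (window w)  = subst (4 * n + toℕ w <_) (+-comm (4 * n) W) (+-monoʳ-< (4 * n) (toℕ<n w))

  index-injective : ∀ {n} → Injective _≡_ _≡_ (index {n})
  index-injective {n} {block k q} {block k′ q′} eq
    with k≡k′ , q≡q′ ← 4*k+q-injective (toℕ<n q) (toℕ<n q′) eq
    with refl ← toℕ-injective {i = k} {j = k′} k≡k′ | refl ← toℕ-injective {i = q} {j = q′} q≡q′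
    = refl
  index-injective {n} {block k q} {window w} eq =
    ⊥-elim (<⇒≢ (≤-trans (4*k+q<4*n (toℕ<n k) (toℕ<n q)) (m≤m+n (4 * n) (toℕ w))) eq)
  index-injective {n} {window w} {block k q} eq =
    ⊥-elim (<⇒≢ (≤-trans (4*k+q<4*n (toℕ<n k) (toℕ<n q)) (m≤m+n (4 * n) (toℕ w))) (sym eq))
  index-injective {n} {window w} {window w′} eq
    with refl ← toℕ-injective {i = w} {j = w′} (+-cancelˡ-≡ (4 * n) _ _ eq) = refl

  column : ∀ {n} → Column n → Fin (M n)
  column c = fromℕ< (index<M c)

  toℕ-column : ∀ {n} (c : Column n) → toℕ (column c) ≡ index c
  toℕ-column c = toℕ-fromℕ< (index<M c)

  column-injective : ∀ {n} → Injective _≡_ _≡_ (column {n})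
  column-injective {_} {c} {c′} eq =
    index-injective (trans (sym (toℕ-column c)) (trans (cong toℕ eq) (toℕ-column c′)))

  -- Moving right by s ≤ 3 from position q of a block either stays in the block or
  -- carries to position q + s - 4 of the next block, or of the window after the last block.
  data BlockTarget : Set where
    inBlock : Fin 4 → BlockTarget
    carry   : Fin 4 → Fin W → BlockTarget

  blockTarget : Fin 4 → ℕ → BlockTarget
  blockTarget q s with toℕ q + s <? 4
  ... | yes q+s<4 = inBlock (fromℕ< q+s<4)
  ... | no _      = carry (residue 4 (toℕ q + s ∸ 4)) (residue W (toℕ q + s ∸ 4))

  -- From the window one wraps around to column w + s - W, in the first block, or in the
  -- window itself if there are no blocks.
  data WindowTarget : Set where
    inWindow : Fin W → WindowTarget
    wrap     : Fin W → Fin 4 → WindowTarget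

  windowTarget : Fin W → ℕ → WindowTarget
  windowTarget w s with toℕ w + s <? W
  ... | yes w+s<W = inWindow (fromℕ< w+s<W)
  ... | no _      = wrap (residue W (toℕ w + s ∸ W)) (residue 4 (toℕ w + s ∸ W))

  addBlock : ∀ {n} → Fin n → BlockTarget → Column n
  addBlock k (inBlock q) = block k q
  addBlock {n} k (carry q w) with suc (toℕ k) <? n
  ... | yes k+1<n = block (fromℕ< k+1<n) q
  ... | no _      = window w

  addWindow : ∀ n → WindowTarget → Column n
  addWindow n       (inWindow w) = window w
  addWindow zero    (wrap w _)   = window w
  addWindow (suc n) (wrap _ q)   = block zero q

  _+ᶜ_ : ∀ {n} → Column n → ℕ → Column n
  block k q +ᶜ s      = addBlock k (blockTarget q s)
  _+ᶜ_ {n} (window w) s = addWindow n (windowTarget w s)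

  index-≡-% : ∀ {n} (c : Column n) {a} → index c ≡ a → index c ≡ a % M n
  index-≡-% {n} c refl = sym (m<n⇒m%n≡m (index<M c))

  ≤2⇒<4 : ∀ {x} → x ≤ 2 → x < 4
  ≤2⇒<4 x≤2 = s≤s (≤-trans x≤2 (s≤s (s≤s z≤n)))

  ≤2⇒<W : ∀ {x} → x ≤ 2 → x < W
  ≤2⇒<W x≤2 = ≤-trans (≤2⇒<4 x≤2) (m≤m+n 4 d)

  index-+ᶜ-block : ∀ {n} (k : Fin n) q s → s ≤ 3 →
                   index (block k q +ᶜ s) ≡ (4 * toℕ k + toℕ q + s) % M n
  index-+ᶜ-block {n} k q s s≤3 with toℕ q + s <? 4
  ... | yes q+s<4 = index-≡-% (block k (fromℕ< q+s<4)) (begin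
    4 * toℕ k + toℕ (fromℕ< q+s<4)  ≡⟨ cong (4 * toℕ k +_) (toℕ-fromℕ< q+s<4) ⟩
    4 * toℕ k + (toℕ q + s)        ≡⟨ +-assoc (4 * toℕ k) (toℕ q) s ⟨
    4 * toℕ k + toℕ q + s          ∎)
    where open ≡-Reasoning
  ... | no q+s≮4 with suc (toℕ k) <? n
  ...   | yes k+1<n = index-≡-% (block (fromℕ< k+1<n) (residue 4 (toℕ q + s ∸ 4))) (begin
    4 * toℕ (fromℕ< k+1<n) + toℕ (residue 4 (toℕ q + s ∸ 4))
      ≡⟨ cong₂ (λ a b → 4 * a + b) (toℕ-fromℕ< k+1<n) (toℕ-residue 4 (≤2⇒<4 ([a+s]∸b≤2 (toℕ<n q) s≤3))) ⟩
    4 * suc (toℕ k) + (toℕ q + s ∸ 4)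
      ≡⟨ carried-index (toℕ k) q+s≮4 ⟩
    4 * toℕ k + toℕ q + s ∎)
    where open ≡-Reasoning
  ...   | no k+1≮n = index-≡-% {n} (window (residue W (toℕ q + s ∸ 4))) (begin
    4 * n + toℕ (residue W (toℕ q + s ∸ 4))
      ≡⟨ cong₂ (λ a b → 4 * a + b) (sym k+1≡n) (toℕ-residue W (≤2⇒<W ([a+s]∸b≤2 (toℕ<n q) s≤3))) ⟩
    4 * suc (toℕ k) + (toℕ q + s ∸ 4)
      ≡⟨ carried-index (toℕ k) q+s≮4 ⟩
    4 * toℕ k + toℕ q + s ∎)
    where
    open ≡-Reasoning
    k+1≡n : suc (toℕ k) ≡ n
    k+1≡n = ≤-antisym (toℕ<n k) (≮⇒≥ k+1≮n)

  index-+ᶜ-window : ∀ {n} w s → s ≤ 3 → index (window {n} w +ᶜ s) ≡ (4 * n + toℕ w + s) % M n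
  index-+ᶜ-window {n} w s s≤3 with toℕ w + s <? W
  ... | yes w+s<W = index-≡-% {n} (window (fromℕ< w+s<W)) (begin
    4 * n + toℕ (fromℕ< w+s<W)  ≡⟨ cong (4 * n +_) (toℕ-fromℕ< w+s<W) ⟩
    4 * n + (toℕ w + s)        ≡⟨ +-assoc (4 * n) (toℕ w) s ⟨
    4 * n + toℕ w + s          ∎)
    where open ≡-Reasoning
  ... | no w+s≮W = begin
    index (addWindow n (wrap (residue W x) (residue 4 x)))  ≡⟨ wrapped-index n ⟩
    x                                                     ≡⟨ m<n⇒m%n≡m x<M ⟨
    x % M n                                               ≡⟨ [m+n]%n≡m%n x (M n) ⟨
    (x + M n) % M n                                       ≡⟨ cong (_% M n) x+M≡4n+w+s ⟩
    (4 * n + toℕ w + s) % M n                             ∎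
    where
    open ≡-Reasoning
    x : ℕ
    x = toℕ w + s ∸ W
    x≤2 : x ≤ 2
    x≤2 = [a+s]∸b≤2 (toℕ<n w) s≤3
    x<M : x < M n
    x<M = ≤-trans (≤2⇒<W x≤2) (m≤m+n W (4 * n))
    wrapped-index : ∀ n → index (addWindow n (wrap (residue W x) (residue 4 x))) ≡ x
    wrapped-index zero    = toℕ-residue W (≤2⇒<W x≤2)
    wrapped-index (suc n) = toℕ-residue 4 (≤2⇒<4 x≤2)
    x+M≡4n+w+s : x + M n ≡ 4 * n + toℕ w + s
    x+M≡4n+w+s = begin
      x + (W + 4 * n)      ≡⟨ +-assoc x W (4 * n) ⟨
      x + W + 4 * n        ≡⟨ cong (_+ 4 * n) (m∸n+n≡m (≮⇒≥ w+s≮W)) ⟩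
      toℕ w + s + 4 * n    ≡⟨ +-comm (toℕ w + s) (4 * n) ⟩
      4 * n + (toℕ w + s)  ≡⟨ +-assoc (4 * n) (toℕ w) s ⟨
      4 * n + toℕ w + s    ∎

  index-+ᶜ : ∀ {n} (c : Column n) s → s ≤ 3 → index (c +ᶜ s) ≡ (index c + s) % M n
  index-+ᶜ (block k q) = index-+ᶜ-block k q
  index-+ᶜ (window w)  = index-+ᶜ-window w

  column-+ᶜ : ∀ {n} (c : Column n) s → s ≤ 3 → column (c +ᶜ s) ≡ ArcsOfG2m.shift (M n) (column c) s
  column-+ᶜ {n} c s s≤3 = toℕ-injective (begin
    toℕ (column (c +ᶜ s))      ≡⟨ toℕ-column (c +ᶜ s) ⟩
    index (c +ᶜ s)             ≡⟨ index-+ᶜ c s s≤3 ⟩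
    (index c + s) % M n        ≡⟨ cong (λ i → (i + s) % M n) (toℕ-column c) ⟨
    (toℕ (column c) + s) % M n ≡⟨ ArcsOfG2m.toℕ-shift (M n) (column c) s ⟨
    toℕ (ArcsOfG2m.shift (M n) (column c) s) ∎)
    where open ≡-Reasoning

  Vertex : ℕ → Set
  Vertex n = Column n × Fin 2

  embed : ∀ {n} → Vertex n → V (G2m (M n))
  embed (c , h) = column c , h

  embed-injective : ∀ {n} → Injective _≡_ _≡_ (embed {n})
  embed-injective {_} {c , h} {c′ , h′} eq with same-column , refl ← ,-injective eq
    with refl ← column-injective {x = c} {y = c′} same-column = refl

  move : ∀ {n} → Fin 5 → Vertex n → Vertex n
  move r (c , h) = c +ᶜ arcStep r , arcLevel r h

  embed-move : ∀ {n} r (u : Vertex n) → embed (move r u) ≡ ArcsOfG2m.arcTarget (M n) r (embed u)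
  embed-move r (c , h) = cong (_, arcLevel r h) (column-+ᶜ c (arcStep r) (arcStep≤3 r))

  module _ {n : ℕ} where
    open ArcsOfG2m (M n)

    move-arc : ∀ r (u : Vertex n) → Arc (G2m (M n)) (embed u) (embed (move r u))
    move-arc r u = subst (Arc (G2m (M n)) (embed u)) (sym (embed-move r u)) (arcTarget-arc r (embed u))

    arc⇒move : ∀ (u : Vertex n) v → Arc (G2m (M n)) (embed u) v → Σ (Fin 5) λ r → embed (move r u) ≡ v
    arc⇒move u v uv with r , hit ← arc⇒arcTarget (embed u) v uv = r , trans (embed-move r u) hit

    move-injective : ∀ (u : Vertex n) {r r′} → embed (move r u) ≡ embed (move r′ u) → r ≡ r′
    move-injective u {r} {r′} eq = arcTarget-injective (m≤m+n 4 (d + 4 * n)) (embed u)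
      (trans (sym (embed-move r u)) (trans eq (embed-move r′ u)))

-- Label and height  c₀ + cₙ n + cₖ k  of a vertex in block k (cₖ is unused in the window).
record Potential : Set where
  constructor potential
  field
    label    : Fin 2
    c₀ cₙ cₖ : ℕ
open Potential

blockHeight : ℕ → ℕ → Potential → Fin 2 × ℕ
blockHeight n k P = label P , c₀ P + cₙ P * n + cₖ P * k

windowHeight : ℕ → Potential → Fin 2 × ℕ
windowHeight n P = label P , c₀ P + cₙ P * n

BlockToBlock : Potential → Potential → Set
BlockToBlock P P′ = label P′ ≡ label P × c₀ P′ ≡ suc (c₀ P) × cₙ P′ ≡ cₙ P × cₖ P′ ≡ cₖ P

BlockToNextBlock : Potential → Potential → Set
BlockToNextBlock P P′ = label P′ ≡ label P × c₀ P′ + cₖ P′ ≡ suc (c₀ P) × cₙ P′ ≡ cₙ P × cₖ P′ ≡ cₖ P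

BlockToWindow : Potential → Potential → Set
BlockToWindow P P′ = label P′ ≡ label P × cₙ P′ ≡ cₙ P + cₖ P × c₀ P′ + cₙ P′ ≡ suc (c₀ P + cₙ P)

WindowToWindow : ℕ → Potential → Potential → Set
WindowToWindow W P P′ = label P′ ≡ label P ×
  ((c₀ P′ ≡ suc (c₀ P) × cₙ P′ ≡ cₙ P) ⊎ (suc (c₀ P) ≡ W × cₙ P ≡ 4 × c₀ P′ ≡ 0 × cₙ P′ ≡ 0))

WindowToFirstBlock : Potential → Potential → Set
WindowToFirstBlock P P′ = label P′ ≡ label P × c₀ P′ ≡ suc (c₀ P) × cₙ P′ ≡ cₙ P

WindowToWindowWithoutBlocks : ℕ → Potential → Potential → Set
WindowToWindowWithoutBlocks W P P′ =
  label P′ ≡ label P × (c₀ P′ ≡ suc (c₀ P) ⊎ (suc (c₀ P) ≡ W × c₀ P′ ≡ 0))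

block-to-block : ∀ {m n k P P′} → BlockToBlock P P′ →
                 Advances m (blockHeight n k P) (blockHeight n k P′)
block-to-block (refl , refl , refl , refl) = refl , inj₁ refl

block-to-next-block : ∀ {m n k P P′} → BlockToNextBlock P P′ →
                      Advances m (blockHeight n k P) (blockHeight n (suc k) P′)
block-to-next-block {n = n} {k} {potential ℓ a b c} {potential .ℓ a′ .b .c}
                    (refl , a′+c≡1+a , refl , refl) = refl , inj₁ (begin
    a′ + b * n + c * suc k   ≡⟨ regroup a′ (b * n) c k ⟩
    a′ + c + b * n + c * k   ≡⟨ cong (λ x → x + b * n + c * k) a′+c≡1+a ⟩
    suc (a + b * n + c * k)  ∎)
  where
  open ≡-Reasoning
  regroup : ∀ x y z k → x + y + z * suc k ≡ x + z + y + z * k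
  regroup = solve-∀

block-to-window : ∀ {m k P P′} → BlockToWindow P P′ →
                  Advances m (blockHeight (suc k) k P) (windowHeight (suc k) P′)
block-to-window {k = k} {potential ℓ a b c} {potential .ℓ a′ .(b + c) _} (refl , refl , a′+b+c≡1+a+b) =
  refl , inj₁ (begin
    a′ + (b + c) * suc k             ≡⟨ regroup₁ a′ (b + c) k ⟩
    a′ + (b + c) + (b + c) * k       ≡⟨ cong (_+ (b + c) * k) a′+b+c≡1+a+b ⟩
    suc (a + b) + (b + c) * k        ≡⟨ regroup₂ a b c k ⟩
    suc (a + b * suc k + c * k)      ∎)
  where
  open ≡-Reasoning
  regroup₁ : ∀ x y k → x + y * suc k ≡ x + y + y * k
  regroup₁ = solve-∀
  regroup₂ : ∀ x y z k → suc (x + y) + (y + z) * k ≡ suc (x + y * suc k + z * k)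
  regroup₂ = solve-∀

window-to-window : ∀ {W n P P′} → WindowToWindow W P P′ →
                   Advances (W + 4 * n) (windowHeight n P) (windowHeight n P′)
window-to-window {P = potential ℓ a b _} {potential .ℓ .(suc a) .b _} (refl , inj₁ (refl , refl)) =
  refl , inj₁ refl
window-to-window {n = n} {potential ℓ a .4 _} {potential .ℓ .0 .0 _}
                 (refl , inj₂ (1+a≡W , refl , refl , refl)) = refl , inj₂ (cong (_+ 4 * n) 1+a≡W , refl)

window-to-first-block : ∀ {m n P P′} → WindowToFirstBlock P P′ →
                        Advances m (windowHeight n P) (blockHeight n 0 P′)
window-to-first-block {n = n} {potential ℓ a b _} {potential .ℓ .(suc a) .b c} (refl , refl , refl) =
  refl , inj₁ (trans (cong (suc a + b * n +_) (*-zeroʳ c)) (+-identityʳ _))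

window-to-window-without-blocks : ∀ {W P P′} → WindowToWindowWithoutBlocks W P P′ →
                                  Advances (W + 4 * 0) (windowHeight 0 P) (windowHeight 0 P′)
window-to-window-without-blocks {W} {potential ℓ a b _} {potential .ℓ a′ b′ _} (refl , a′≡1+a⊎wrap) =
  refl , ⊎-map advance wrap a′≡1+a⊎wrap
  where
  height₀ : ∀ x y → x + y * 0 ≡ x
  height₀ x y = trans (cong (x +_) (*-zeroʳ y)) (+-identityʳ x)
  advance : a′ ≡ suc a → a′ + b′ * 0 ≡ suc (a + b * 0)
  advance a′≡1+a = trans (height₀ a′ b′) (trans a′≡1+a (cong suc (sym (height₀ a b))))
  wrap : suc a ≡ W × a′ ≡ 0 → suc (a + b * 0) ≡ W + 4 * 0 × a′ + b′ * 0 ≡ 0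
  wrap (1+a≡W , a′≡0) =
    trans (cong suc (height₀ a b)) (trans 1+a≡W (sym (+-identityʳ W))) , trans (height₀ a′ b′) a′≡0

blockToBlock? : ∀ P P′ → Dec (BlockToBlock P P′)
blockToBlock? P P′ =
  label P′ ≟ᶠ label P ×-dec c₀ P′ ≟ suc (c₀ P) ×-dec cₙ P′ ≟ cₙ P ×-dec cₖ P′ ≟ cₖ P

blockToNextBlock? : ∀ P P′ → Dec (BlockToNextBlock P P′)
blockToNextBlock? P P′ =
  label P′ ≟ᶠ label P ×-dec c₀ P′ + cₖ P′ ≟ suc (c₀ P) ×-dec cₙ P′ ≟ cₙ P ×-dec cₖ P′ ≟ cₖ P

blockToWindow? : ∀ P P′ → Dec (BlockToWindow P P′)
blockToWindow? P P′ =
  label P′ ≟ᶠ label P ×-dec cₙ P′ ≟ cₙ P + cₖ P ×-dec c₀ P′ + cₙ P′ ≟ suc (c₀ P + cₙ P)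

windowToWindow? : ∀ W P P′ → Dec (WindowToWindow W P P′)
windowToWindow? W P P′ = label P′ ≟ᶠ label P ×-dec
  ((c₀ P′ ≟ suc (c₀ P) ×-dec cₙ P′ ≟ cₙ P) ⊎-dec
   (suc (c₀ P) ≟ W ×-dec cₙ P ≟ 4 ×-dec c₀ P′ ≟ 0 ×-dec cₙ P′ ≟ 0))

windowToFirstBlock? : ∀ P P′ → Dec (WindowToFirstBlock P P′)
windowToFirstBlock? P P′ = label P′ ≟ᶠ label P ×-dec c₀ P′ ≟ suc (c₀ P) ×-dec cₙ P′ ≟ cₙ P

windowToWindowWithoutBlocks? : ∀ W P P′ → Dec (WindowToWindowWithoutBlocks W P P′)
windowToWindowWithoutBlocks? W P P′ =
  label P′ ≟ᶠ label P ×-dec (c₀ P′ ≟ suc (c₀ P) ⊎-dec (suc (c₀ P) ≟ W ×-dec c₀ P′ ≟ 0))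

module Certificates (d : ℕ) where
  open ColumnLayout d

  heightOn : ∀ {n} → (Fin 4 → Potential) → (Fin W → Potential) → Column n → Fin 2 × ℕ
  heightOn {n} Pᵇ _  (block k q) = blockHeight n (toℕ k) (Pᵇ q)
  heightOn {n} _  Pʷ (window w)  = windowHeight n (Pʷ w)

  BlockStepTo : Potential → (Fin 4 → Potential) → (Fin W → Potential) → BlockTarget → Set
  BlockStepTo P Pᵇ Pʷ (inBlock q′)  = BlockToBlock P (Pᵇ q′)
  BlockStepTo P Pᵇ Pʷ (carry q′ w′) = BlockToNextBlock P (Pᵇ q′) × BlockToWindow P (Pʷ w′)

  WindowStepTo : Potential → (Fin 4 → Potential) → (Fin W → Potential) → WindowTarget → Set
  WindowStepTo P Pᵇ Pʷ (inWindow w′) = WindowToWindow W P (Pʷ w′)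
  WindowStepTo P Pᵇ Pʷ (wrap w′ q′)  =
    WindowToWindowWithoutBlocks W P (Pʷ w′) × WindowToFirstBlock P (Pᵇ q′)

  blockStepTo? : ∀ P Pᵇ Pʷ t → Dec (BlockStepTo P Pᵇ Pʷ t)
  blockStepTo? P Pᵇ Pʷ (inBlock q′)  = blockToBlock? P (Pᵇ q′)
  blockStepTo? P Pᵇ Pʷ (carry q′ w′) = blockToNextBlock? P (Pᵇ q′) ×-dec blockToWindow? P (Pʷ w′)

  windowStepTo? : ∀ P Pᵇ Pʷ t → Dec (WindowStepTo P Pᵇ Pʷ t)
  windowStepTo? P Pᵇ Pʷ (inWindow w′) = windowToWindow? W P (Pʷ w′)
  windowStepTo? P Pᵇ Pʷ (wrap w′ q′)  =
    windowToWindowWithoutBlocks? W P (Pʷ w′) ×-dec windowToFirstBlock? P (Pᵇ q′)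

  addBlock-advances : ∀ {n} (k : Fin n) {P} Pᵇ Pʷ t → BlockStepTo P Pᵇ Pʷ t →
                      Advances (M n) (blockHeight n (toℕ k) P) (heightOn Pᵇ Pʷ (addBlock k t))
  addBlock-advances k Pᵇ Pʷ (inBlock q′) step = block-to-block step
  addBlock-advances {n} k {P} Pᵇ Pʷ (carry q′ w′) (to-next , to-window) with suc (toℕ k) <? n
  ... | yes k+1<n = subst (λ k′ → Advances (M n) (blockHeight n (toℕ k) P) (blockHeight n k′ (Pᵇ q′)))
                          (sym (toℕ-fromℕ< k+1<n)) (block-to-next-block {P = P} {Pᵇ q′} to-next)
  ... | no k+1≮n = subst (λ n → Advances (M n) (blockHeight n (toℕ k) P) (windowHeight n (Pʷ w′)))
                         (≤-antisym (toℕ<n k) (≮⇒≥ k+1≮n)) (block-to-window {P = P} {Pʷ w′} to-window)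

  addWindow-advances : ∀ n {P} Pᵇ Pʷ t → WindowStepTo P Pᵇ Pʷ t →
                       Advances (M n) (windowHeight n P) (heightOn Pᵇ Pʷ (addWindow n t))
  addWindow-advances n {P} Pᵇ Pʷ (inWindow w′) step = window-to-window {P = P} {Pʷ w′} step
  addWindow-advances zero {P} Pᵇ Pʷ (wrap w′ q′) (to-window , _) =
    window-to-window-without-blocks {P = P} {Pʷ w′} to-window
  addWindow-advances (suc n) {P} Pᵇ Pʷ (wrap w′ q′) (_ , to-block) =
    window-to-first-block {P = P} {Pᵇ q′} to-block

  record Tables : Set where
    field
      blockRule       : Fin 5 → Fin 4 → Fin 2 → Fin 5
      windowRule      : Fin 5 → Fin W → Fin 2 → Fin 5
      blockPotential  : Fin 5 → Fin 4 → Fin 2 → Potential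
      windowPotential : Fin 5 → Fin W → Fin 2 → Potential
      base            : Fin 5 → Fin 2 → Fin W × Fin 2

  module _ (T : Tables) where
    open Tables T

    BlockStep : Fin 5 → Fin 4 → Fin 2 → Set
    BlockStep c q h =
      BlockStepTo (blockPotential c q h) (λ q′ → blockPotential c q′ h′) (λ w′ → windowPotential c w′ h′)
                  (blockTarget q (arcStep (blockRule c q h)))
      where
      h′ : Fin 2
      h′ = arcLevel (blockRule c q h) h

    WindowStep : Fin 5 → Fin W → Fin 2 → Set
    WindowStep c w h =
      WindowStepTo (windowPotential c w h) (λ q′ → blockPotential c q′ h′) (λ w′ → windowPotential c w′ h′)
                   (windowTarget w (arcStep (windowRule c w h)))
      where
      h′ : Fin 2
      h′ = arcLevel (windowRule c w h) h

    BaseHeight : Fin 5 → Fin 2 → Set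
    BaseHeight c i = label P ≡ i × c₀ P ≡ 0 × cₙ P ≡ 0
      where
      P : Potential
      P = windowPotential c (proj₁ (base c i)) (proj₂ (base c i))

    BlockRuleLatin WindowRuleLatin : Set
    BlockRuleLatin = ∀ q h → (∀ c c′ → blockRule c q h ≡ blockRule c′ q h → c ≡ c′) ×
                             (∀ r → Σ (Fin 5) λ c → blockRule c q h ≡ r)
    WindowRuleLatin = ∀ w h → (∀ c c′ → windowRule c w h ≡ windowRule c′ w h → c ≡ c′) ×
                              (∀ r → Σ (Fin 5) λ c → windowRule c w h ≡ r)

    -- A finite, decidable condition on the tables which, by the lemmas above, makes every
    -- σ_c raise the height by one modulo M n, for all n at once.
    record Valid : Set where
      constructor valid
      field
        block-step        : ∀ c q h → BlockStep c q h
        window-step       : ∀ c w h → WindowStep c w h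
        base-height       : ∀ c i → BaseHeight c i
        blockRule-latin   : BlockRuleLatin
        windowRule-latin  : WindowRuleLatin

    valid? : Dec Valid
    valid? = map′ (λ (b , w , h , bl , wl) → valid b w h bl wl)
                  (λ (valid b w h bl wl) → b , w , h , bl , wl)
      (     (all? λ c → all? λ q → all? λ h → blockStepTo? _ _ _ _)
      ×-dec (all? λ c → all? λ w → all? λ h → windowStepTo? _ _ _ _)
      ×-dec (all? λ c → all? λ i → baseHeight? c i)
      ×-dec (all? λ q → all? λ h →
               (all? λ c → all? λ c′ → blockRule c q h ≟ᶠ blockRule c′ q h →-dec c ≟ᶠ c′)
               ×-dec (all? λ r → any? λ c → blockRule c q h ≟ᶠ r))
      ×-dec (all? λ w → all? λ h →
               (all? λ c → all? λ c′ → windowRule c w h ≟ᶠ windowRule c′ w h →-dec c ≟ᶠ c′)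
               ×-dec (all? λ r → any? λ c → windowRule c w h ≟ᶠ r)))
      where
      baseHeight? : ∀ c i → Dec (BaseHeight c i)
      baseHeight? c i = label P ≟ᶠ i ×-dec c₀ P ≟ 0 ×-dec cₙ P ≟ 0
        where
        P : Potential
        P = windowPotential c (proj₁ (base c i)) (proj₂ (base c i))

  module FromCertificate (T : Tables) (v : Valid T) where
    open Tables T
    open Valid v

    rule : ∀ {n} → Fin 5 → Vertex n → Fin 5
    rule c (block _ q , h) = blockRule c q h
    rule c (window w , h)  = windowRule c w h

    σ : ∀ {n} → Fin 5 → Vertex n → Vertex n
    σ c u = move (rule c u) u

    rule-injective : ∀ {n} (u : Vertex n) {c c′} → rule c u ≡ rule c′ u → c ≡ c′
    rule-injective (block _ q , h) = proj₁ (blockRule-latin q h) _ _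
    rule-injective (window w , h)  = proj₁ (windowRule-latin w h) _ _

    rule-surjective : ∀ {n} (u : Vertex n) r → Σ (Fin 5) λ c → rule c u ≡ r
    rule-surjective (block _ q , h) = proj₂ (blockRule-latin q h)
    rule-surjective (window w , h)  = proj₂ (windowRule-latin w h)

    height : ∀ {n} → Fin 5 → Vertex n → Fin 2 × ℕ
    height c (x , h) = heightOn (λ q → blockPotential c q h) (λ w → windowPotential c w h) x

    height-advances : ∀ {n} c (u : Vertex n) → Advances (M n) (height c u) (height c (σ c u))
    height-advances c (block k q , h) = addBlock-advances k _ _ _ (block-step c q h)
    height-advances c (window w , h)  = addWindow-advances _ _ _ _ (window-step c w h)

    baseVertex : ∀ {n} → Fin 5 → Fin 2 → Vertex n
    baseVertex c i = window (proj₁ (base c i)) , proj₂ (base c i)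

    height-base : ∀ {n} c i → height {n} c (baseVertex c i) ≡ (i , 0)
    height-base {n} c i with label≡i , c₀≡0 , cₙ≡0 ← base-height c i =
      cong₂ _,_ label≡i (cong₂ (λ a b → a + b * n) c₀≡0 cₙ≡0)

    module Factor (n : ℕ) (c : Fin 5) =
      CyclesFromHeight {m = M n} {t = 2} (σ {n} c) (height c) (height-advances c) (baseVertex c)
                        (height-base c) embed (embed-injective {n})

    cmFactorization : ∀ n → CmFactorization (M n) (G2m (M n))
    cmFactorization n = FactorizationFromRules.cmFactorization (G2m (M n)) {m = M n} {k = 5} {t = 2}
      embed embed-injective (Factor.ext-surjective n zero)
      move move-arc arc⇒move move-injective
      rule rule-injective rule-surjective
      (Factor.cycle n) (Factor.cycle-injective n) (Factor.cycle-surjective n) (Factor.cycle-next n)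

-- Table entries for one column and level: the arc type used, then the potential
-- (label , c₀ , cₙ , cₖ), without cₖ in the window.
BlockEntry WindowEntry : Set
BlockEntry  = ℕ × ℕ × ℕ × ℕ × ℕ
WindowEntry = ℕ × ℕ × ℕ × ℕ

-- One factor: its entries for levels 0 and 1 at the four block positions and the W window
-- columns, and the window vertices (column , level) where its two cycles have height 0.
record FactorData (W : ℕ) : Set where
  constructor factor
  field
    blockColumns  : Vec (BlockEntry × BlockEntry) 4
    windowColumns : Vec (WindowEntry × WindowEntry) W
    cycleStarts   : (ℕ × ℕ) × (ℕ × ℕ)
open FactorData

atLevel : {A : Set} → Fin 2 → A × A → A
atLevel zero       = proj₁
atLevel (suc zero) = proj₂

module _ (d : ℕ) where
  open ColumnLayout d
  open Certificates d

  tablesFrom : Vec (FactorData W) 5 → Tables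
  tablesFrom fs = record
    { blockRule       = λ c q h → residue 5 (proj₁ (blockEntry c q h))
    ; windowRule      = λ c w h → residue 5 (proj₁ (windowEntry c w h))
    ; blockPotential  = λ c q h → let (_ , ℓ , a , b , k) = blockEntry c q h in potential (residue 2 ℓ) a b k
    ; windowPotential = λ c w h → let (_ , ℓ , a , b) = windowEntry c w h in potential (residue 2 ℓ) a b 0
    ; base            = λ c i → let (w , h) = atLevel i (cycleStarts (lookup fs c))
                                in residue W w , residue 2 h
    }
    where
    blockEntry : Fin 5 → Fin 4 → Fin 2 → BlockEntry
    blockEntry c q h = atLevel h (lookup (blockColumns (lookup fs c)) q)
    windowEntry : Fin 5 → Fin W → Fin 2 → WindowEntry
    windowEntry c w h = atLevel h (lookup (windowColumns (lookup fs c)) w)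

factors₉ : Vec (FactorData 9) 5
factors₉ =
    factor
      ( ((0 , 1 , 8 , 2 , 2) , (0 , 0 , 7 , 2 , 2))
      ∷ ((2 , 1 , 9 , 2 , 2) , (2 , 0 , 8 , 2 , 2))
      ∷ ((0 , 1 , 5 , 0 , 2) , (0 , 0 , 4 , 0 , 2))
      ∷ ((2 , 1 , 6 , 0 , 2) , (2 , 0 , 5 , 0 , 2))
      ∷ [] )
      ( ((2 , 1 , 8 , 4) , (0 , 0 , 7 , 4))
      ∷ ((2 , 0 , 0 , 0) , (4 , 0 , 8 , 4))
      ∷ ((1 , 1 , 5 , 2) , (2 , 0 , 4 , 2))
      ∷ ((1 , 1 , 0 , 0) , (2 , 1 , 6 , 2))
      ∷ ((0 , 0 , 1 , 0) , (3 , 1 , 1 , 0))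
      ∷ ((3 , 0 , 2 , 0) , (1 , 0 , 5 , 2))
      ∷ ((3 , 0 , 6 , 2) , (3 , 1 , 7 , 2))
      ∷ ((4 , 1 , 2 , 0) , (1 , 1 , 3 , 0))
      ∷ ((2 , 1 , 4 , 0) , (2 , 0 , 3 , 0))
      ∷ [] )
      ((1 , 0) , (3 , 0))
  ∷ factor
      ( ((1 , 0 , 8 , 2 , 2) , (3 , 1 , 7 , 2 , 2))
      ∷ ((1 , 0 , 4 , 0 , 2) , (3 , 0 , 9 , 2 , 2))
      ∷ ((1 , 1 , 4 , 0 , 2) , (3 , 0 , 5 , 0 , 2))
      ∷ ((1 , 1 , 8 , 2 , 2) , (3 , 1 , 5 , 0 , 2))
      ∷ [] )
      ( ((1 , 0 , 8 , 4) , (2 , 1 , 7 , 4))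
      ∷ ((1 , 0 , 4 , 2) , (2 , 0 , 0 , 0))
      ∷ ((3 , 1 , 4 , 2) , (3 , 0 , 5 , 2))
      ∷ ((2 , 1 , 0 , 0) , (4 , 1 , 8 , 4))
      ∷ ((3 , 0 , 2 , 0) , (4 , 0 , 1 , 0))
      ∷ ((2 , 0 , 6 , 2) , (0 , 1 , 5 , 2))
      ∷ ((0 , 1 , 1 , 0) , (2 , 1 , 6 , 2))
      ∷ ((1 , 1 , 2 , 0) , (3 , 0 , 3 , 0))
      ∷ ((0 , 0 , 7 , 2) , (3 , 1 , 3 , 0))
      ∷ [] )
      ((1 , 1) , (3 , 0))
  ∷ factor
      ( ((2 , 0 , 9 , 0 , 4) , (4 , 0 , 8 , 0 , 4))
      ∷ ((4 , 1 , 8 , 0 , 4) , (0 , 1 , 9 , 0 , 4))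
      ∷ ((2 , 1 , 11 , 0 , 4) , (4 , 1 , 10 , 0 , 4))
      ∷ ((4 , 0 , 10 , 0 , 4) , (0 , 0 , 11 , 0 , 4))
      ∷ [] )
      ( ((3 , 0 , 0 , 0) , (4 , 0 , 8 , 4))
      ∷ ((4 , 1 , 8 , 4) , (1 , 1 , 0 , 0))
      ∷ ((4 , 1 , 1 , 0) , (1 , 1 , 2 , 0))
      ∷ ((3 , 1 , 3 , 0) , (1 , 0 , 1 , 0))
      ∷ ((4 , 0 , 2 , 0) , (1 , 0 , 3 , 0))
      ∷ ((4 , 0 , 4 , 0) , (2 , 0 , 5 , 0))
      ∷ ((1 , 1 , 5 , 0) , (4 , 1 , 4 , 0))
      ∷ ((2 , 1 , 7 , 0) , (4 , 1 , 6 , 0))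
      ∷ ((1 , 0 , 7 , 0) , (4 , 0 , 6 , 0))
      ∷ [] )
      ((0 , 0) , (1 , 1))
  ∷ factor
      ( ((3 , 0 , 8 , 2 , 2) , (1 , 0 , 4 , 0 , 2))
      ∷ ((3 , 0 , 5 , 0 , 2) , (1 , 1 , 4 , 0 , 2))
      ∷ ((3 , 1 , 5 , 0 , 2) , (1 , 1 , 8 , 2 , 2))
      ∷ ((3 , 1 , 9 , 2 , 2) , (1 , 0 , 9 , 2 , 2))
      ∷ [] )
      ( ((0 , 0 , 8 , 4) , (3 , 0 , 4 , 2))
      ∷ ((3 , 0 , 0 , 0) , (3 , 1 , 4 , 2))
      ∷ ((2 , 1 , 0 , 0) , (4 , 1 , 8 , 4))
      ∷ ((4 , 0 , 5 , 2) , (3 , 0 , 6 , 2))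
      ∷ ((1 , 1 , 5 , 2) , (2 , 0 , 1 , 0))
      ∷ ((1 , 1 , 1 , 0) , (3 , 1 , 6 , 2))
      ∷ ((2 , 0 , 7 , 2) , (1 , 1 , 2 , 0))
      ∷ ((3 , 1 , 3 , 0) , (0 , 0 , 2 , 0))
      ∷ ((3 , 1 , 7 , 2) , (0 , 0 , 3 , 0))
      ∷ [] )
      ((1 , 0) , (2 , 0))
  ∷ factor
      ( ((4 , 0 , 8 , 0 , 4) , (2 , 0 , 9 , 0 , 4))
      ∷ ((0 , 1 , 9 , 0 , 4) , (4 , 1 , 8 , 0 , 4))
      ∷ ((4 , 1 , 10 , 0 , 4) , (2 , 1 , 11 , 0 , 4))
      ∷ ((0 , 0 , 11 , 0 , 4) , (4 , 0 , 10 , 0 , 4))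
      ∷ [] )
      ( ((4 , 0 , 8 , 4) , (1 , 0 , 0 , 0))
      ∷ ((0 , 0 , 1 , 0) , (0 , 1 , 8 , 4))
      ∷ ((0 , 0 , 2 , 0) , (0 , 1 , 0 , 0))
      ∷ ((0 , 0 , 3 , 0) , (0 , 1 , 1 , 0))
      ∷ ((2 , 0 , 4 , 0) , (0 , 1 , 2 , 0))
      ∷ ((0 , 1 , 4 , 0) , (4 , 1 , 3 , 0))
      ∷ ((4 , 1 , 5 , 0) , (0 , 1 , 6 , 0))
      ∷ ((0 , 0 , 5 , 0) , (2 , 1 , 7 , 0))
      ∷ ((4 , 0 , 6 , 0) , (1 , 0 , 7 , 0))
      ∷ [] )
      ((0 , 1) , (2 , 1))
  ∷ []

factors₁₁ : Vec (FactorData 11) 5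
factors₁₁ =
    factor
      ( ((0 , 0 , 4 , 0 , 2) , (2 , 0 , 10 , 2 , 2))
      ∷ ((2 , 0 , 5 , 0 , 2) , (0 , 1 , 10 , 2 , 2))
      ∷ ((0 , 1 , 4 , 0 , 2) , (2 , 1 , 11 , 2 , 2))
      ∷ ((2 , 1 , 5 , 0 , 2) , (0 , 0 , 11 , 2 , 2))
      ∷ [] )
      ( ((3 , 0 , 4 , 2) , (1 , 0 , 10 , 4))
      ∷ ((1 , 0 , 0 , 0) , (3 , 1 , 10 , 4))
      ∷ ((2 , 1 , 4 , 2) , (2 , 0 , 1 , 0))
      ∷ ((2 , 0 , 6 , 2) , (4 , 0 , 5 , 2))
      ∷ ((4 , 1 , 0 , 0) , (3 , 1 , 1 , 0))
      ∷ ((1 , 1 , 5 , 2) , (3 , 0 , 2 , 0))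
      ∷ ((3 , 0 , 7 , 2) , (0 , 1 , 6 , 2))
      ∷ ((3 , 1 , 2 , 0) , (0 , 1 , 7 , 2))
      ∷ ((2 , 0 , 3 , 0) , (1 , 1 , 8 , 2))
      ∷ ((3 , 1 , 9 , 2) , (1 , 0 , 8 , 2))
      ∷ ((1 , 0 , 9 , 2) , (3 , 1 , 3 , 0))
      ∷ [] )
      ((1 , 0) , (4 , 0))
  ∷ factor
      ( ((1 , 0 , 4 , 0 , 2) , (1 , 0 , 9 , 2 , 2))
      ∷ ((3 , 0 , 10 , 2 , 2) , (3 , 0 , 5 , 0 , 2))
      ∷ ((1 , 1 , 4 , 0 , 2) , (1 , 1 , 10 , 2 , 2))
      ∷ ((3 , 1 , 11 , 2 , 2) , (3 , 1 , 5 , 0 , 2))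
      ∷ [] )
      ( ((2 , 0 , 4 , 2) , (0 , 0 , 9 , 4))
      ∷ ((2 , 0 , 0 , 0) , (4 , 0 , 10 , 4))
      ∷ ((3 , 1 , 4 , 2) , (0 , 1 , 10 , 4))
      ∷ ((1 , 0 , 5 , 2) , (3 , 1 , 0 , 0))
      ∷ ((0 , 0 , 1 , 0) , (2 , 0 , 6 , 2))
      ∷ ((3 , 0 , 2 , 0) , (0 , 1 , 5 , 2))
      ∷ ((0 , 1 , 1 , 0) , (2 , 1 , 6 , 2))
      ∷ ((2 , 1 , 2 , 0) , (1 , 0 , 7 , 2))
      ∷ ((3 , 0 , 8 , 2) , (3 , 0 , 3 , 0))
      ∷ ((1 , 1 , 8 , 2) , (4 , 1 , 7 , 2))
      ∷ ((2 , 1 , 3 , 0) , (2 , 1 , 9 , 2))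
      ∷ [] )
      ((1 , 0) , (3 , 1))
  ∷ factor
      ( ((2 , 0 , 10 , 2 , 2) , (0 , 0 , 4 , 0 , 2))
      ∷ ((0 , 1 , 10 , 2 , 2) , (2 , 0 , 5 , 0 , 2))
      ∷ ((2 , 1 , 11 , 2 , 2) , (0 , 1 , 6 , 0 , 2))
      ∷ ((0 , 0 , 11 , 2 , 2) , (2 , 1 , 7 , 0 , 2))
      ∷ [] )
      ( ((1 , 0 , 10 , 4) , (2 , 0 , 4 , 2))
      ∷ ((0 , 1 , 10 , 4) , (2 , 0 , 0 , 0))
      ∷ ((0 , 1 , 0 , 0) , (3 , 1 , 6 , 2))
      ∷ ((3 , 1 , 1 , 0) , (1 , 0 , 5 , 2))
      ∷ ((2 , 0 , 6 , 2) , (0 , 0 , 1 , 0))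
      ∷ ((2 , 1 , 7 , 2) , (2 , 0 , 2 , 0))
      ∷ ((2 , 1 , 3 , 0) , (4 , 1 , 2 , 0))
      ∷ ((4 , 0 , 7 , 2) , (2 , 0 , 8 , 2))
      ∷ ((1 , 1 , 8 , 2) , (2 , 0 , 3 , 0))
      ∷ ((0 , 1 , 4 , 0) , (3 , 1 , 9 , 2))
      ∷ ((3 , 1 , 5 , 0) , (1 , 0 , 9 , 2))
      ∷ [] )
      ((1 , 1) , (2 , 0))
  ∷ factor
      ( ((3 , 0 , 11 , 0 , 4) , (4 , 0 , 10 , 0 , 4))
      ∷ ((1 , 1 , 11 , 0 , 4) , (4 , 1 , 10 , 0 , 4))
      ∷ ((3 , 1 , 13 , 0 , 4) , (4 , 1 , 12 , 0 , 4))
      ∷ ((1 , 0 , 13 , 0 , 4) , (4 , 0 , 12 , 0 , 4))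
      ∷ [] )
      ( ((0 , 0 , 0 , 0) , (4 , 0 , 10 , 4))
      ∷ ((3 , 0 , 1 , 0) , (1 , 1 , 10 , 4))
      ∷ ((4 , 1 , 0 , 0) , (1 , 1 , 1 , 0))
      ∷ ((4 , 1 , 2 , 0) , (2 , 1 , 3 , 0))
      ∷ ((1 , 0 , 3 , 0) , (4 , 0 , 2 , 0))
      ∷ ((0 , 0 , 5 , 0) , (4 , 0 , 4 , 0))
      ∷ ((1 , 0 , 6 , 0) , (1 , 1 , 4 , 0))
      ∷ ((1 , 1 , 5 , 0) , (3 , 0 , 7 , 0))
      ∷ ((0 , 1 , 7 , 0) , (4 , 1 , 6 , 0))
      ∷ ((4 , 1 , 8 , 0) , (2 , 1 , 9 , 0))
      ∷ ((4 , 0 , 8 , 0) , (0 , 0 , 9 , 0))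
      ∷ [] )
      ((0 , 0) , (2 , 0))
  ∷ factor
      ( ((4 , 0 , 10 , 0 , 4) , (3 , 0 , 11 , 0 , 4))
      ∷ ((4 , 1 , 10 , 0 , 4) , (1 , 1 , 11 , 0 , 4))
      ∷ ((4 , 1 , 12 , 0 , 4) , (3 , 1 , 13 , 0 , 4))
      ∷ ((4 , 0 , 12 , 0 , 4) , (1 , 0 , 13 , 0 , 4))
      ∷ [] )
      ( ((4 , 0 , 10 , 4) , (3 , 0 , 0 , 0))
      ∷ ((4 , 1 , 10 , 4) , (0 , 1 , 0 , 0))
      ∷ ((1 , 1 , 2 , 0) , (4 , 1 , 1 , 0))
      ∷ ((0 , 0 , 1 , 0) , (0 , 1 , 3 , 0))
      ∷ ((3 , 0 , 2 , 0) , (1 , 1 , 4 , 0))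
      ∷ ((4 , 1 , 5 , 0) , (1 , 1 , 6 , 0))
      ∷ ((4 , 1 , 7 , 0) , (3 , 1 , 8 , 0))
      ∷ ((0 , 0 , 4 , 0) , (4 , 0 , 3 , 0))
      ∷ ((4 , 0 , 5 , 0) , (0 , 0 , 6 , 0))
      ∷ ((2 , 1 , 9 , 0) , (0 , 0 , 7 , 0))
      ∷ ((0 , 0 , 9 , 0) , (4 , 0 , 8 , 0))
      ∷ [] )
      ((0 , 1) , (1 , 1))
  ∷ []

valid₉ : Certificates.Valid 5 (tablesFrom 5 factors₉)
valid₉ = toWitness {a? = Certificates.valid? 5 (tablesFrom 5 factors₉)} tt

valid₁₁ : Certificates.Valid 7 (tablesFrom 7 factors₁₁)
valid₁₁ = toWitness {a? = Certificates.valid? 7 (tablesFrom 7 factors₁₁)} tt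

odd-residue-mod-4 : ∀ m → m % 2 ≡ 1 → m % 4 ≡ 1 ⊎ m % 4 ≡ 3
odd-residue-mod-4 m odd = cases (m % 4) (m%n<n m 4) (trans (m∣n⇒o%n%m≡o%m 2 4 m (divides 2 refl)) odd)
  where
  cases : ∀ r → r < 4 → r % 2 ≡ 1 → r ≡ 1 ⊎ r ≡ 3
  cases 1 _ _ = inj₁ refl
  cases 3 _ _ = inj₂ refl
  cases 0 _ ()
  cases 2 _ ()
  cases (suc (suc (suc (suc _)))) (s≤s (s≤s (s≤s (s≤s ())))) _

odd≥11-shape : ∀ m → 11 ≤ m → m % 2 ≡ 1 → (∃ λ n → m ≡ 9 + 4 * n) ⊎ (∃ λ n → m ≡ 11 + 4 * n)
odd≥11-shape m 11≤m odd =
  shape (m % 4) (m / 4) (odd-residue-mod-4 m odd) m≡r+4q (subst (11 ≤_) m≡r+4q 11≤m)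
  where
  m≡r+4q : m ≡ m % 4 + m / 4 * 4
  m≡r+4q = m≡m%n+[m/n]*n m 4
  shape : ∀ r q → r ≡ 1 ⊎ r ≡ 3 → m ≡ r + q * 4 → 11 ≤ r + q * 4 →
          (∃ λ n → m ≡ 9 + 4 * n) ⊎ (∃ λ n → m ≡ 11 + 4 * n)
  shape _ (suc (suc n)) (inj₁ refl) eq _ = inj₁ (n , trans eq (cong (9 +_) (*-comm n 4)))
  shape _ (suc (suc n)) (inj₂ refl) eq _ = inj₂ (n , trans eq (cong (11 +_) (*-comm n 4)))
  shape _ 0 (inj₁ refl) _ (s≤s ())
  shape _ 1 (inj₁ refl) _ (s≤s (s≤s (s≤s (s≤s (s≤s ())))))
  shape _ 0 (inj₂ refl) _ (s≤s (s≤s (s≤s ())))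
  shape _ 1 (inj₂ refl) _ (s≤s (s≤s (s≤s (s≤s (s≤s (s≤s (s≤s ())))))))

proposition19 : (m : ℕ) .{{_ : NonZero m}} → 11 ≤ m → m % 2 ≡ 1 →
                CmFactorization m (G2m m)
proposition19 m 11≤m odd with odd≥11-shape m 11≤m odd
... | inj₁ (n , refl) = Certificates.FromCertificate.cmFactorization 5 _ valid₉ n
... | inj₂ (n , refl) = Certificates.FromCertificate.cmFactorization 7 _ valid₁₁ n
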